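{- For every integer $t\geq1$, the Cayley digraph $$G_t=\mathrm{Cay}\big(\mathbb{Z}_t\oplus\mathbb{Z}_t\oplus\mathbb{Z}_{84t},\ \{(1,10,-38),(0,1,-3),(0,-2,7)\}\big)$$ has order $N_t=84t^3$ and diameter $k_t=10t-3$.
   Context: $\mathbb{Z}_m$ denotes the cyclic group of integers modulo $m$; the generator triples are read componentwise modulo $t$, $t$, $84t$ respectively. The diameter of a Cayley digraph is the maximum over vertices $v$ of the length of a shortest directed path from $0$ to $v$ using the generators as arcs. -}

module Defs where

open import Data.Nat as ℕ using (ℕ; zero; suc; _≤_; NonZero)
open import Data.Nat.Properties using (m*n≢0)
open import Data.Integer as ℤ using (ℤ; +_; -_; _%ℕ_)
open import Data.Integer.DivMod using (n%ℕd<d)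
open import Data.Fin using (Fin; toℕ; fromℕ<)
open import Data.Product using (_×_; _,_; ∃; Σ)
open import Data.List using (List; _∷_; [])
open import Data.List.Membership.Propositional using (_∈_)

_modFin_ : ℤ → (m : ℕ) → .{{NonZero m}} → Fin m
z modFin m = fromℕ< (n%ℕd<d z m)

addMod : (m : ℕ) → .{{NonZero m}} → Fin m → ℤ → Fin m
addMod m x g = ((+ toℕ x) ℤ.+ g) modFin m

module Gt (t : ℕ) .{{t≢0 : NonZero t}} where

  M : ℕ
  M = 84 ℕ.* t

  instance
    M≢0 : NonZero M
    M≢0 = m*n≢0 84 t

  Vertex : Set
  Vertex = Fin t × Fin t × Fin M

  origin : Vertex
  origin = ((+ 0) modFin t) , ((+ 0) modFin t) , ((+ 0) modFin M)

  -- Group element triples, read componentwise mod t, t, 84t.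
  Triple : Set
  Triple = ℤ × ℤ × ℤ

  gens : List Triple
  gens = (+ 1 , + 10 , - (+ 38))
       ∷ (+ 0 , + 1 , - (+ 3))
       ∷ (+ 0 , - (+ 2) , + 7)
       ∷ []

  _⊕_ : Vertex → Triple → Vertex
  (a , b , c) ⊕ (x , y , z) = addMod t a x , addMod t b y , addMod M c z

  data Path : Vertex → ℕ → Set where
    nil  : Path origin 0
    snoc : ∀ {v n g} → Path v n → g ∈ gens → Path (v ⊕ g) (suc n)

  -- D is the diameter: every vertex is at distance ≤ D from 0, and some
  -- vertex has distance ≥ D (all walks to it have length ≥ D), i.e. D is the
  -- maximum over v of the shortest-path distance from 0 to v.
  IsDiameter : ℕ → Set
  IsDiameter D =
    ((v : Vertex) → ∃ λ n → n ≤ D × Path v n) ×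
    (∃ λ (v : Vertex) → ∀ n → Path v n → D ≤ n)

-- The group is abelian, so a walk from 0 is determined up to order by how often it uses each
-- generator, and one using them x, y, z times ends at the image of (x, y, z) under the matrix whose
-- columns are the generators. That matrix has determinant 1, so two such walks end at the same vertex
-- exactly when x, y, z agree modulo t and, writing each as residue + (block count)·t, the block
-- counts (a, b, c) and (a', b', c') have weights -38a - 3b + 7c congruent modulo 84. Every residue
-- modulo 84 is the weight of at most 7 blocks, giving walks of length at most 3(t-1) + 7t = 10t - 3
-- to every vertex; the weight 49 needs 7 blocks, so the vertex with residues t-1 and blocks (0,0,7)
-- is at distance 10t - 3.

module Submission where

open import Defs
open import Data.Nat using (ℕ; NonZero; _*_; _^_; _∸_)
open import Data.Fin using (Fin)
open import Data.Product using (_×_)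
open import Function.Bundles using (_↔_)

open import Data.Nat as ℕ using (zero; suc; _≤_; _<_; _≤?_; _<?_; ≤-pred)
open import Data.Nat.Properties
  using (≤-trans; ≤-<-trans; ≰⇒>; n<1+n; ⊔-pres-<m; +-suc; m+n∸m≡n; +-mono-≤; +-monoʳ-≤; *-monoˡ-≤;
         m≤m+n; m≤n+m; anyUpTo?; allUpTo?; module ≤-Reasoning)
open import Data.Nat.DivMod using (_%_; _/_; m<n⇒m%n≡m; m≡m%n+[m/n]*n; m%n<n)
open import Data.Nat.Divisibility using (n∣m⇒m%n≡0)
import Data.Nat.Tactic.RingSolver as ℕ-Solver
open import Data.Integer as ℤ using (ℤ; +_; -_; _+_; _-_; _%ℕ_; _/ℕ_)
open import Data.Integer.Properties
  using (+-injective; +-comm; i-j≡0⇒i≡j; ∣i∣≡0⇒i≡0; m-n≡m⊖n; ∣m⊝n∣≤m⊔n; pos-*)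
open import Data.Integer.DivMod using (n%ℕd<d; a≡a%ℕn+[a/ℕn]*n)
open import Data.Integer.Divisibility.Signed
  using (_∣_; divides; _∣?_; ∣⇒∣ᵤ; ∣-trans; ∣m∣n⇒∣m+n; ∣m⇒∣-m; ∣n⇒∣m*n; *-monoˡ-∣; *-cancelʳ-∣)
open import Data.Integer.Tactic.RingSolver using (solve-∀)
open import Data.Fin using (toℕ)
open import Data.Fin.Properties using (toℕ-fromℕ<; toℕ-injective; toℕ<n; *↔×)
open import Data.Product using (∃; _,_; proj₁; proj₂)
open import Data.List.Relation.Unary.Any using (here; there)
open import Data.Unit using (tt)
open import Function using (_∘_)
open import Function.Properties.Inverse using (↔-sym; ↔-trans; ↔-refl)
open import Data.Product.Function.NonDependent.Propositional using (_×-↔_)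
open import Relation.Nullary using (¬_; ¬?; yes; no; contradiction)
open import Relation.Nullary.Decidable using (_×-dec_; _→-dec_; toWitness)
open import Relation.Binary.PropositionalEquality

cong₃ : ∀ {A B C D : Set} (f : A → B → C → D) {x x' y y' z z'} →
        x ≡ x' → y ≡ y' → z ≡ z' → f x y z ≡ f x' y' z'
cong₃ f refl refl refl = refl

∣r-s⇒r≡s : ∀ {m r s} .{{_ : NonZero m}} → r < m → s < m → + m ∣ + r - + s → r ≡ s
∣r-s⇒r≡s {m} {r} {s} r<m s<m m∣r-s =
  +-injective (i-j≡0⇒i≡j (+ r) (+ s) (∣i∣≡0⇒i≡0 ∣r-s∣≡0))
  where
  ∣r-s∣<m : ℤ.∣ + r - + s ∣ < m
  ∣r-s∣<m = subst (_< m) (cong ℤ.∣_∣ (sym (m-n≡m⊖n r s)))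
              (≤-<-trans (∣m⊝n∣≤m⊔n r s) (⊔-pres-<m r<m s<m))
  ∣r-s∣≡0 : ℤ.∣ + r - + s ∣ ≡ 0
  ∣r-s∣≡0 = trans (sym (m<n⇒m%n≡m ∣r-s∣<m)) (n∣m⇒m%n≡0 _ m (∣⇒∣ᵤ m∣r-s))

∣[r+am]-[s+bm]⇒r≡s : ∀ {m r s} .{{_ : NonZero m}} a b → r < m → s < m →
                     + m ∣ + (r ℕ.+ a * m) - + (s ℕ.+ b * m) → r ≡ s
∣[r+am]-[s+bm]⇒r≡s {m} {r} {s} a b r<m s<m m∣Δ = ∣r-s⇒r≡s r<m s<m
  (subst (+ m ∣_) (trans (cong₂ (λ A B → (+ r + A) - (+ s + B) + (+ b - + a) ℤ.* + m) (pos-* a m) (pos-* b m))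
                         (cancel (+ r) (+ s) (+ a) (+ b) (+ m)))
     (∣m∣n⇒∣m+n m∣Δ (divides (+ b - + a) refl)))
  where
  cancel : ∀ R S A B M → (R + A ℤ.* M) - (S + B ℤ.* M) + (B - A) ℤ.* M ≡ R - S
  cancel = solve-∀

∣A-[A%m] : ∀ m .{{_ : NonZero m}} A → + m ∣ A - + (A %ℕ m)
∣A-[A%m] m A = divides (A /ℕ m)
  (trans (cong (_- + (A %ℕ m)) (a≡a%ℕn+[a/ℕn]*n A m)) (cancel (+ (A %ℕ m)) (A /ℕ m) (+ m)))
  where
  cancel : ∀ r q M → (r + q ℤ.* M) - r ≡ q ℤ.* M
  cancel = solve-∀

toℕ-modFin : ∀ m .{{_ : NonZero m}} A → toℕ (A modFin m) ≡ A %ℕ m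
toℕ-modFin m A = toℕ-fromℕ< (n%ℕd<d A m)

∣⇒modFin-≡ : ∀ m .{{_ : NonZero m}} A B → + m ∣ A - B → A modFin m ≡ B modFin m
∣⇒modFin-≡ m A B m∣A-B = toℕ-injective (begin
  toℕ (A modFin m)  ≡⟨ toℕ-modFin m A ⟩
  A %ℕ m            ≡⟨ ∣r-s⇒r≡s (n%ℕd<d A m) (n%ℕd<d B m) m∣rA-rB ⟩
  B %ℕ m            ≡⟨ toℕ-modFin m B ⟨
  toℕ (B modFin m)  ∎)
  where
  open ≡-Reasoning
  rearrange : ∀ rA rB A B → rA - rB ≡ - (A - rA) + (A - B) + (B - rB)
  rearrange = solve-∀
  m∣rA-rB : + m ∣ + (A %ℕ m) - + (B %ℕ m)
  m∣rA-rB = subst (+ m ∣_) (sym (rearrange (+ (A %ℕ m)) (+ (B %ℕ m)) A B))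
    (∣m∣n⇒∣m+n (∣m∣n⇒∣m+n (∣m⇒∣-m (∣A-[A%m] m A)) m∣A-B) (∣A-[A%m] m B))

modFin-≡⇒∣ : ∀ m .{{_ : NonZero m}} A B → A modFin m ≡ B modFin m → + m ∣ A - B
modFin-≡⇒∣ m A B eq = subst (+ m ∣_) (sym (rearrange A B (+ (B %ℕ m))))
  (∣m∣n⇒∣m+n (subst (λ r → + m ∣ A - + r) rA≡rB (∣A-[A%m] m A)) (∣m⇒∣-m (∣A-[A%m] m B)))
  where
  rA≡rB : A %ℕ m ≡ B %ℕ m
  rA≡rB = trans (sym (toℕ-modFin m A)) (trans (cong toℕ eq) (toℕ-modFin m B))
  rearrange : ∀ A B r → A - B ≡ (A - r) + - (B - r)
  rearrange = solve-∀

+toℕ-modFin : ∀ m .{{_ : NonZero m}} (f : Fin m) → (+ toℕ f) modFin m ≡ f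
+toℕ-modFin m f = toℕ-injective (trans (toℕ-modFin m (+ toℕ f)) (m<n⇒m%n≡m (toℕ<n f)))

addMod-modFin : ∀ m .{{_ : NonZero m}} A g → addMod m (A modFin m) g ≡ (A + g) modFin m
addMod-modFin m A g = trans (cong (λ r → (+ r + g) modFin m) (toℕ-modFin m A))
  (∣⇒modFin-≡ m (+ (A %ℕ m) + g) (A + g)
    (subst (+ m ∣_) (rearrange (+ (A %ℕ m)) A g) (∣m⇒∣-m (∣A-[A%m] m A))))
  where
  rearrange : ∀ r A g → - (A - r) ≡ (r + g) - (A + g)
  rearrange = solve-∀

form : ℤ × ℤ × ℤ → ℤ → ℤ → ℤ → ℤ
form (p , q , r) X Y Z = p ℤ.* X + q ℤ.* Y + r ℤ.* Z

form-+ : ∀ ρ X Y Z X' Y' Z' → form ρ (X + X') (Y + Y') (Z + Z') ≡ form ρ X Y Z + form ρ X' Y' Z'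
form-+ (p , q , r) = distrib p q r
  where
  distrib : ∀ p q r X Y Z X' Y' Z' → p ℤ.* (X + X') + q ℤ.* (Y + Y') + r ℤ.* (Z + Z')
          ≡ (p ℤ.* X + q ℤ.* Y + r ℤ.* Z) + (p ℤ.* X' + q ℤ.* Y' + r ℤ.* Z')
  distrib = solve-∀

form-- : ∀ ρ X Y Z X' Y' Z' → form ρ X Y Z - form ρ X' Y' Z' ≡ form ρ (X - X') (Y - Y') (Z - Z')
form-- (p , q , r) = distrib p q r
  where
  distrib : ∀ p q r X Y Z X' Y' Z' → (p ℤ.* X + q ℤ.* Y + r ℤ.* Z) - (p ℤ.* X' + q ℤ.* Y' + r ℤ.* Z')
          ≡ p ℤ.* (X - X') + q ℤ.* (Y - Y') + r ℤ.* (Z - Z')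
  distrib = solve-∀

form-* : ∀ ρ X Y Z T → form ρ (X ℤ.* T) (Y ℤ.* T) (Z ℤ.* T) ≡ form ρ X Y Z ℤ.* T
form-* (p , q , r) = distrib p q r
  where
  distrib : ∀ p q r X Y Z T → p ℤ.* (X ℤ.* T) + q ℤ.* (Y ℤ.* T) + r ℤ.* (Z ℤ.* T)
          ≡ (p ℤ.* X + q ℤ.* Y + r ℤ.* Z) ℤ.* T
  distrib = solve-∀

form-blocks : ∀ ρ m x y z a b c →
  form ρ (+ (x ℕ.+ a * m)) (+ (y ℕ.+ b * m)) (+ (z ℕ.+ c * m))
    ≡ form ρ (+ x) (+ y) (+ z) + form ρ (+ a) (+ b) (+ c) ℤ.* + m
form-blocks ρ m x y z a b c = begin
  form ρ (+ (x ℕ.+ a * m)) (+ (y ℕ.+ b * m)) (+ (z ℕ.+ c * m))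
    ≡⟨ form-+ ρ (+ x) (+ y) (+ z) (+ (a * m)) (+ (b * m)) (+ (c * m)) ⟩
  form ρ (+ x) (+ y) (+ z) + form ρ (+ (a * m)) (+ (b * m)) (+ (c * m))
    ≡⟨ cong (_+_ (form ρ (+ x) (+ y) (+ z))) blocks ⟩
  form ρ (+ x) (+ y) (+ z) + form ρ (+ a) (+ b) (+ c) ℤ.* + m  ∎
  where
  open ≡-Reasoning
  blocks : form ρ (+ (a * m)) (+ (b * m)) (+ (c * m)) ≡ form ρ (+ a) (+ b) (+ c) ℤ.* + m
  blocks = trans (cong₃ (form ρ) (pos-* a m) (pos-* b m) (pos-* c m)) (form-* ρ (+ a) (+ b) (+ c) (+ m))

form-blocks-- : ∀ ρ m x y z a b c a' b' c' →
  form ρ (+ (x ℕ.+ a * m)) (+ (y ℕ.+ b * m)) (+ (z ℕ.+ c * m))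
    - form ρ (+ (x ℕ.+ a' * m)) (+ (y ℕ.+ b' * m)) (+ (z ℕ.+ c' * m))
    ≡ (form ρ (+ a) (+ b) (+ c) - form ρ (+ a') (+ b') (+ c')) ℤ.* + m
form-blocks-- ρ m x y z a b c a' b' c' =
  trans (cong₂ _-_ (form-blocks ρ m x y z a b c) (form-blocks ρ m x y z a' b' c'))
        (cancel (form ρ (+ x) (+ y) (+ z)) (form ρ (+ a) (+ b) (+ c)) (form ρ (+ a') (+ b') (+ c')) (+ m))
  where
  cancel : ∀ F W W' M → (F + W ℤ.* M) - (F + W' ℤ.* M) ≡ (W - W') ℤ.* M
  cancel = solve-∀

pos-combination : ∀ a b c x y z → + (a * x ℕ.+ b * y ℕ.+ c * z) ≡ form (+ a , + b , + c) (+ x) (+ y) (+ z)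
pos-combination a b c x y z = cong₂ _+_ (cong₂ _+_ (pos-* a x) (pos-* b y)) (pos-* c z)

-- The matrix whose columns are the generators

row₁ row₂ row₃ : ℤ × ℤ × ℤ
row₁ = + 1 , + 0 , + 0
row₂ = + 10 , + 1 , - + 2
row₃ = - + 38 , - + 3 , + 7

image : ℤ → ℤ → ℤ → ℤ × ℤ × ℤ
image X Y Z = form row₁ X Y Z , form row₂ X Y Z , form row₃ X Y Z

-- The matrix has determinant 1; its inverse has rows (1,0,0), (6,7,2), (8,3,1).
preimage : ℤ → ℤ → ℤ → ℤ × ℤ × ℤ
preimage P Q R = P , form (+ 6 , + 7 , + 2) P Q R , form (+ 8 , + 3 , + 1) P Q R

image-preimage : ∀ P Q R → let (X , Y , Z) = preimage P Q R in image X Y Z ≡ (P , Q , R)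
image-preimage P Q R = cong₂ _,_ (inverse₁ P Q R) (cong₂ _,_ (inverse₂ P Q R) (inverse₃ P Q R))
  where
  inverse₁ : ∀ P Q R → + 1 ℤ.* P + + 0 ℤ.* (+ 6 ℤ.* P + + 7 ℤ.* Q + + 2 ℤ.* R)
                       + + 0 ℤ.* (+ 8 ℤ.* P + + 3 ℤ.* Q + + 1 ℤ.* R) ≡ P
  inverse₁ = solve-∀
  inverse₂ : ∀ P Q R → + 10 ℤ.* P + + 1 ℤ.* (+ 6 ℤ.* P + + 7 ℤ.* Q + + 2 ℤ.* R)
                       + - + 2 ℤ.* (+ 8 ℤ.* P + + 3 ℤ.* Q + + 1 ℤ.* R) ≡ Q
  inverse₂ = solve-∀
  inverse₃ : ∀ P Q R → - + 38 ℤ.* P + - + 3 ℤ.* (+ 6 ℤ.* P + + 7 ℤ.* Q + + 2 ℤ.* R)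
                       + + 7 ℤ.* (+ 8 ℤ.* P + + 3 ℤ.* Q + + 1 ℤ.* R) ≡ R
  inverse₃ = solve-∀

image-unimodular : ∀ {k} X Y Z → k ∣ form row₁ X Y Z → k ∣ form row₂ X Y Z → k ∣ form row₃ X Y Z →
                   k ∣ X × k ∣ Y × k ∣ Z
image-unimodular X Y Z k∣U k∣V k∣W =
    subst (_ ∣_) (inverse₁ X Y Z) k∣U
  , subst (_ ∣_) (inverse₂ X Y Z) (combination (+ 6) (+ 7) (+ 2))
  , subst (_ ∣_) (inverse₃ X Y Z) (combination (+ 8) (+ 3) (+ 1))
  where
  combination : ∀ p q r → _ ∣ p ℤ.* form row₁ X Y Z + q ℤ.* form row₂ X Y Z + r ℤ.* form row₃ X Y Z
  combination p q r = ∣m∣n⇒∣m+n (∣m∣n⇒∣m+n (∣n⇒∣m*n p k∣U) (∣n⇒∣m*n q k∣V)) (∣n⇒∣m*n r k∣W)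
  inverse₁ : ∀ X Y Z → + 1 ℤ.* X + + 0 ℤ.* Y + + 0 ℤ.* Z ≡ X
  inverse₁ = solve-∀
  inverse₂ : ∀ X Y Z → + 6 ℤ.* (+ 1 ℤ.* X + + 0 ℤ.* Y + + 0 ℤ.* Z) + + 7 ℤ.* (+ 10 ℤ.* X + + 1 ℤ.* Y + - + 2 ℤ.* Z)
                       + + 2 ℤ.* (- + 38 ℤ.* X + - + 3 ℤ.* Y + + 7 ℤ.* Z) ≡ Y
  inverse₂ = solve-∀
  inverse₃ : ∀ X Y Z → + 8 ℤ.* (+ 1 ℤ.* X + + 0 ℤ.* Y + + 0 ℤ.* Z) + + 3 ℤ.* (+ 10 ℤ.* X + + 1 ℤ.* Y + - + 2 ℤ.* Z)
                       + + 1 ℤ.* (- + 38 ℤ.* X + - + 3 ℤ.* Y + + 7 ℤ.* Z) ≡ Z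
  inverse₃ = solve-∀

-- Weights of blocks modulo 84

weight : ℕ → ℕ → ℕ → ℤ
weight a b c = form row₃ (+ a) (+ b) (+ c)

weight-residues : ∀ {k} → k < 84 →
  ∃ λ a → a < 8 × ∃ λ b → b < 8 × ∃ λ c → c < 8 × (a ℕ.+ b ℕ.+ c ≤ 7 × + 84 ∣ weight a b c - + k)
weight-residues = toWitness {a? = allUpTo? (λ k → anyUpTo? (λ a → anyUpTo? (λ b → anyUpTo? (λ c →
  (a ℕ.+ b ℕ.+ c ≤? 7) ×-dec (+ 84 ∣? weight a b c - + k)) 8) 8) 8) 84} tt

weight-covers : ∀ K → ∃ λ a → ∃ λ b → ∃ λ c → a ℕ.+ b ℕ.+ c ≤ 7 × + 84 ∣ weight a b c - K
weight-covers K = extend (weight-residues (n%ℕd<d K 84))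
  where
  rearrange : ∀ W k K → (W - k) + - (K - k) ≡ W - K
  rearrange = solve-∀
  extend : (∃ λ a → a < 8 × ∃ λ b → b < 8 × ∃ λ c → c < 8 ×
             (a ℕ.+ b ℕ.+ c ≤ 7 × + 84 ∣ weight a b c - + (K %ℕ 84))) →
           ∃ λ a → ∃ λ b → ∃ λ c → a ℕ.+ b ℕ.+ c ≤ 7 × + 84 ∣ weight a b c - K
  extend (a , _ , b , _ , c , _ , small , 84∣w-k) =
    a , b , c , small , subst (+ 84 ∣_) (rearrange (weight a b c) (+ (K %ℕ 84)) K)
                          (∣m∣n⇒∣m+n 84∣w-k (∣m⇒∣-m (∣A-[A%m] 84 K)))

weight-49-needs-seven : ∀ {a} → a < 7 → ∀ {b} → b < 7 → ∀ {c} → c < 7 →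
  a ℕ.+ b ℕ.+ c < 7 → ¬ (+ 84 ∣ weight a b c - + 49)
weight-49-needs-seven = toWitness {a? = allUpTo? (λ a → allUpTo? (λ b → allUpTo? (λ c →
  (a ℕ.+ b ℕ.+ c <? 7) →-dec ¬? (+ 84 ∣? weight a b c - + 49)) 7) 7) 7} tt

84∣weight-49⇒7≤a+b+c : ∀ a b c → + 84 ∣ weight a b c - + 49 → 7 ≤ a ℕ.+ b ℕ.+ c
84∣weight-49⇒7≤a+b+c a b c 84∣w-49 with 7 ≤? a ℕ.+ b ℕ.+ c
... | yes 7≤a+b+c = 7≤a+b+c
... | no 7≰a+b+c = contradiction 84∣w-49 (weight-49-needs-seven a<7 b<7 c<7 a+b+c<7)
  where
  a+b+c<7 : a ℕ.+ b ℕ.+ c < 7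
  a+b+c<7 = ≰⇒> 7≰a+b+c
  a<7 : a < 7
  a<7 = ≤-<-trans (≤-trans (m≤m+n a b) (m≤m+n (a ℕ.+ b) c)) a+b+c<7
  b<7 : b < 7
  b<7 = ≤-<-trans (≤-trans (m≤n+m b a) (m≤m+n (a ℕ.+ b) c)) a+b+c<7
  c<7 : c < 7
  c<7 = ≤-<-trans (m≤n+m c (a ℕ.+ b)) a+b+c<7

module Cayley (t-1 : ℕ) where

  t : ℕ
  t = suc t-1

  open Gt t

  reduce : Triple → Vertex
  reduce (a , b , c) = a modFin t , b modFin t , c modFin M

  _≈_ : Triple → Triple → Set
  (a , b , c) ≈ (a' , b' , c') = + t ∣ a - a' × + t ∣ b - b' × + M ∣ c - c'

  reduce-≡⇒≈ : ∀ u v → reduce u ≡ reduce v → u ≈ v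
  reduce-≡⇒≈ (a , b , c) (a' , b' , c') eq =
    modFin-≡⇒∣ t a a' (cong proj₁ eq) , modFin-≡⇒∣ t b b' (cong (proj₁ ∘ proj₂) eq) ,
    modFin-≡⇒∣ M c c' (cong (proj₂ ∘ proj₂) eq)

  ≈⇒reduce-≡ : ∀ u v → u ≈ v → reduce u ≡ reduce v
  ≈⇒reduce-≡ (a , b , c) (a' , b' , c') (t∣a-a' , t∣b-b' , M∣c-c') =
    cong₂ _,_ (∣⇒modFin-≡ t a a' t∣a-a') (cong₂ _,_ (∣⇒modFin-≡ t b b' t∣b-b') (∣⇒modFin-≡ M c c' M∣c-c'))

  +M≡84*t : + M ≡ + 84 ℤ.* + t
  +M≡84*t = pos-* 84 t

  point : ℕ → ℕ → ℕ → Vertex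
  point x y z = reduce (image (+ x) (+ y) (+ z))

  -- Each generator is the image of a unit vector, so the arc along it increments one coordinate.
  point-⊕ : ∀ x y z x' y' z' → point x y z ⊕ image (+ x') (+ y') (+ z') ≡ point (x' ℕ.+ x) (y' ℕ.+ y) (z' ℕ.+ z)
  point-⊕ x y z x' y' z' = cong₂ _,_ (step t row₁) (cong₂ _,_ (step t row₂) (step M row₃))
    where
    step : ∀ m .{{_ : NonZero m}} ρ →
      addMod m (form ρ (+ x) (+ y) (+ z) modFin m) (form ρ (+ x') (+ y') (+ z'))
        ≡ form ρ (+ (x' ℕ.+ x)) (+ (y' ℕ.+ y)) (+ (z' ℕ.+ z)) modFin m
    step m ρ = trans (addMod-modFin m (form ρ (+ x) (+ y) (+ z)) (form ρ (+ x') (+ y') (+ z')))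
      (cong (_modFin m) (trans (+-comm (form ρ (+ x) (+ y) (+ z)) (form ρ (+ x') (+ y') (+ z')))
                               (sym (form-+ ρ (+ x') (+ y') (+ z') (+ x) (+ y) (+ z)))))

  walk : ∀ x y z → Path (point x y z) (x ℕ.+ y ℕ.+ z)
  walk zero    zero    zero    = nil
  walk (suc x) zero    zero    = subst (λ v → Path v _) (point-⊕ x 0 0 1 0 0) (snoc (walk x 0 0) (here refl))
  walk x       (suc y) zero    = subst₂ Path (point-⊕ x y 0 0 1 0) (sym (cong (ℕ._+ 0) (+-suc x y)))
                                   (snoc (walk x y 0) (there (here refl)))
  walk x       y       (suc z) = subst₂ Path (point-⊕ x y z 0 0 1) (sym (+-suc (x ℕ.+ y) z))
                                   (snoc (walk x y z) (there (there (here refl))))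

  path⇒point : ∀ {v n} → Path v n → ∃ λ x → ∃ λ y → ∃ λ z → x ℕ.+ y ℕ.+ z ≡ n × point x y z ≡ v
  path⇒point nil = 0 , 0 , 0 , refl , refl
  path⇒point (snoc p (here refl)) with path⇒point p
  ... | x , y , z , refl , refl = suc x , y , z , refl , sym (point-⊕ x y z 1 0 0)
  path⇒point (snoc p (there (here refl))) with path⇒point p
  ... | x , y , z , refl , refl = x , suc y , z , cong (ℕ._+ z) (+-suc x y) , sym (point-⊕ x y z 0 1 0)
  path⇒point (snoc p (there (there (here refl)))) with path⇒point p
  ... | x , y , z , refl , refl = x , y , suc z , +-suc (x ℕ.+ y) z , sym (point-⊕ x y z 0 0 1)

  point-≡⇒∣ : ∀ x y z x' y' z' → point x y z ≡ point x' y' z' →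
              + t ∣ + x - + x' × + t ∣ + y - + y' × + t ∣ + z - + z'
  point-≡⇒∣ x y z x' y' z' eq = image-unimodular (+ x - + x') (+ y - + y') (+ z - + z')
    (linear row₁ (proj₁ Δ)) (linear row₂ (proj₁ (proj₂ Δ)))
    (linear row₃ (∣-trans (divides (+ 84) +M≡84*t) (proj₂ (proj₂ Δ))))
    where
    linear : ∀ ρ → + t ∣ form ρ (+ x) (+ y) (+ z) - form ρ (+ x') (+ y') (+ z') →
             + t ∣ form ρ (+ x - + x') (+ y - + y') (+ z - + z')
    linear ρ = subst (+ t ∣_) (form-- ρ (+ x) (+ y) (+ z) (+ x') (+ y') (+ z'))
    Δ : image (+ x) (+ y) (+ z) ≈ image (+ x') (+ y') (+ z')
    Δ = reduce-≡⇒≈ (image (+ x) (+ y) (+ z)) (image (+ x') (+ y') (+ z')) eq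

  point-periodic : ∀ x y z a b c a' b' c' → + 84 ∣ weight a b c - weight a' b' c' →
    point (x ℕ.+ a * t) (y ℕ.+ b * t) (z ℕ.+ c * t) ≡ point (x ℕ.+ a' * t) (y ℕ.+ b' * t) (z ℕ.+ c' * t)
  point-periodic x y z a b c a' b' c' 84∣Δw = ≈⇒reduce-≡ (image X Y Z) (image X' Y' Z')
    (divides (Δ row₁) (shift row₁) , divides (Δ row₂) (shift row₂) ,
     subst₂ _∣_ (sym +M≡84*t) (sym (shift row₃)) (*-monoˡ-∣ (+ t) 84∣Δw))
    where
    X Y Z X' Y' Z' : ℤ
    X = + (x ℕ.+ a * t)
    Y = + (y ℕ.+ b * t)
    Z = + (z ℕ.+ c * t)
    X' = + (x ℕ.+ a' * t)
    Y' = + (y ℕ.+ b' * t)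
    Z' = + (z ℕ.+ c' * t)
    Δ : ℤ × ℤ × ℤ → ℤ
    Δ ρ = form ρ (+ a) (+ b) (+ c) - form ρ (+ a') (+ b') (+ c')
    shift : ∀ ρ → form ρ X Y Z - form ρ X' Y' Z' ≡ Δ ρ ℤ.* + t
    shift ρ = form-blocks-- ρ t x y z a b c a' b' c'

  point-≡⇒ : ∀ {r₁ r₂ r₃ s₁ s₂ s₃} a b c a' b' c' →
    r₁ < t → r₂ < t → r₃ < t → s₁ < t → s₂ < t → s₃ < t →
    point (r₁ ℕ.+ a * t) (r₂ ℕ.+ b * t) (r₃ ℕ.+ c * t) ≡ point (s₁ ℕ.+ a' * t) (s₂ ℕ.+ b' * t) (s₃ ℕ.+ c' * t) →
    (r₁ ≡ s₁ × r₂ ≡ s₂ × r₃ ≡ s₃) × + 84 ∣ weight a b c - weight a' b' c'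
  point-≡⇒ {r₁} {r₂} {r₃} {s₁} {s₂} {s₃} a b c a' b' c' r₁<t r₂<t r₃<t s₁<t s₂<t s₃<t eq =
    (r₁≡s₁ , r₂≡s₂ , r₃≡s₃) , *-cancelʳ-∣ (+ t) (subst₂ _∣_ +M≡84*t Δ₃≡ M∣Δ₃)
    where
    t∣Δ : + t ∣ + (r₁ ℕ.+ a * t) - + (s₁ ℕ.+ a' * t) × + t ∣ + (r₂ ℕ.+ b * t) - + (s₂ ℕ.+ b' * t)
        × + t ∣ + (r₃ ℕ.+ c * t) - + (s₃ ℕ.+ c' * t)
    t∣Δ = point-≡⇒∣ (r₁ ℕ.+ a * t) (r₂ ℕ.+ b * t) (r₃ ℕ.+ c * t) (s₁ ℕ.+ a' * t) (s₂ ℕ.+ b' * t) (s₃ ℕ.+ c' * t) eq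
    r₁≡s₁ : r₁ ≡ s₁
    r₁≡s₁ = ∣[r+am]-[s+bm]⇒r≡s a a' r₁<t s₁<t (proj₁ t∣Δ)
    r₂≡s₂ : r₂ ≡ s₂
    r₂≡s₂ = ∣[r+am]-[s+bm]⇒r≡s b b' r₂<t s₂<t (proj₁ (proj₂ t∣Δ))
    r₃≡s₃ : r₃ ≡ s₃
    r₃≡s₃ = ∣[r+am]-[s+bm]⇒r≡s c c' r₃<t s₃<t (proj₂ (proj₂ t∣Δ))
    W W' : ℤ
    W = form row₃ (+ (r₁ ℕ.+ a * t)) (+ (r₂ ℕ.+ b * t)) (+ (r₃ ℕ.+ c * t))
    W' = form row₃ (+ (s₁ ℕ.+ a' * t)) (+ (s₂ ℕ.+ b' * t)) (+ (s₃ ℕ.+ c' * t))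
    M∣Δ₃ : + M ∣ W - W'
    M∣Δ₃ = proj₂ (proj₂ (reduce-≡⇒≈ (image (+ (r₁ ℕ.+ a * t)) (+ (r₂ ℕ.+ b * t)) (+ (r₃ ℕ.+ c * t)))
                                      (image (+ (s₁ ℕ.+ a' * t)) (+ (s₂ ℕ.+ b' * t)) (+ (s₃ ℕ.+ c' * t))) eq))
    Δ₃≡ : W - W' ≡ (weight a b c - weight a' b' c') ℤ.* + t
    Δ₃≡ = trans (cong (_-_ W) (cong₃ (λ u v w → form row₃ (+ (u ℕ.+ a' * t)) (+ (v ℕ.+ b' * t)) (+ (w ℕ.+ c' * t)))
                                   (sym r₁≡s₁) (sym r₂≡s₂) (sym r₃≡s₃)))
                (form-blocks-- row₃ t r₁ r₂ r₃ a b c a' b' c')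

  point-residues : ∀ x y z → point x y z ≡ point (x % t ℕ.+ (x / t) * t) (y % t ℕ.+ (y / t) * t) (z % t ℕ.+ (z / t) * t)
  point-residues x y z = cong₃ point (m≡m%n+[m/n]*n x t) (m≡m%n+[m/n]*n y t) (m≡m%n+[m/n]*n z t)

  point-surjective : ∀ v → ∃ λ x → ∃ λ y → ∃ λ z → point x y z ≡ v
  point-surjective (p , q , r) =
    toℕ p , 6 * toℕ p ℕ.+ 7 * toℕ q ℕ.+ 2 * toℕ r , 8 * toℕ p ℕ.+ 3 * toℕ q ℕ.+ 1 * toℕ r , (begin
    reduce (image (+ toℕ p) (+ (6 * toℕ p ℕ.+ 7 * toℕ q ℕ.+ 2 * toℕ r)) (+ (8 * toℕ p ℕ.+ 3 * toℕ q ℕ.+ 1 * toℕ r)))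
      ≡⟨ cong reduce (cong₂ (image (+ toℕ p)) (pos-combination 6 7 2 (toℕ p) (toℕ q) (toℕ r))
                                              (pos-combination 8 3 1 (toℕ p) (toℕ q) (toℕ r))) ⟩
    reduce (image (+ toℕ p) (form (+ 6 , + 7 , + 2) (+ toℕ p) (+ toℕ q) (+ toℕ r))
                            (form (+ 8 , + 3 , + 1) (+ toℕ p) (+ toℕ q) (+ toℕ r)))
      ≡⟨ cong reduce (image-preimage (+ toℕ p) (+ toℕ q) (+ toℕ r)) ⟩
    reduce (+ toℕ p , + toℕ q , + toℕ r)
      ≡⟨ cong₃ (λ p q r → p , q , r) (+toℕ-modFin t p) (+toℕ-modFin t q) (+toℕ-modFin M r) ⟩
    p , q , r ∎)
    where open ≡-Reasoning

  D : ℕ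
  D = 10 * t ∸ 3

  D≡3[t-1]+7t : D ≡ (t-1 ℕ.+ t-1 ℕ.+ t-1) ℕ.+ 7 * t
  D≡3[t-1]+7t = trans (cong (_∸ 3) (ten t-1)) (trans (m+n∸m≡n 3 (7 ℕ.+ 10 * t-1)) (seven t-1))
    where
    ten : ∀ n → 10 * suc n ≡ 3 ℕ.+ (7 ℕ.+ 10 * n)
    ten = ℕ-Solver.solve-∀
    seven : ∀ n → 7 ℕ.+ 10 * n ≡ (n ℕ.+ n ℕ.+ n) ℕ.+ 7 * suc n
    seven = ℕ-Solver.solve-∀

  length-blocks : ∀ r₁ r₂ r₃ a b c →
    (r₁ ℕ.+ a * t) ℕ.+ (r₂ ℕ.+ b * t) ℕ.+ (r₃ ℕ.+ c * t) ≡ (r₁ ℕ.+ r₂ ℕ.+ r₃) ℕ.+ (a ℕ.+ b ℕ.+ c) * t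
  length-blocks r₁ r₂ r₃ a b c = regroup r₁ r₂ r₃ a b c t
    where
    regroup : ∀ r₁ r₂ r₃ a b c t → (r₁ ℕ.+ a * t) ℕ.+ (r₂ ℕ.+ b * t) ℕ.+ (r₃ ℕ.+ c * t)
                                   ≡ (r₁ ℕ.+ r₂ ℕ.+ r₃) ℕ.+ (a ℕ.+ b ℕ.+ c) * t
    regroup = ℕ-Solver.solve-∀

  point-within-D : ∀ x y z → ∃ λ n → n ≤ D × Path (point x y z) n
  point-within-D x y z = from-blocks (weight-covers (weight (x / t) (y / t) (z / t)))
    where
    residue : ∀ w → w % t ≤ t-1
    residue w = ≤-pred (m%n<n w t)
    from-blocks : (∃ λ a → ∃ λ b → ∃ λ c → a ℕ.+ b ℕ.+ c ≤ 7 × + 84 ∣ weight a b c - weight (x / t) (y / t) (z / t)) →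
                  ∃ λ n → n ≤ D × Path (point x y z) n
    from-blocks (a , b , c , a+b+c≤7 , 84∣Δw) =
      _ , length≤D , subst (λ v → Path v (x′ ℕ.+ y′ ℕ.+ z′)) same-point (walk x′ y′ z′)
      where
      x′ y′ z′ : ℕ
      x′ = x % t ℕ.+ a * t
      y′ = y % t ℕ.+ b * t
      z′ = z % t ℕ.+ c * t
      same-point : point x′ y′ z′ ≡ point x y z
      same-point = trans (point-periodic (x % t) (y % t) (z % t) a b c (x / t) (y / t) (z / t) 84∣Δw)
                         (sym (point-residues x y z))
      length≤D : x′ ℕ.+ y′ ℕ.+ z′ ≤ D
      length≤D = subst₂ _≤_ (sym (length-blocks (x % t) (y % t) (z % t) a b c)) (sym D≡3[t-1]+7t)
        (+-mono-≤ (+-mono-≤ (+-mono-≤ (residue x) (residue y)) (residue z)) (*-monoˡ-≤ t a+b+c≤7))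

  reach : (v : Vertex) → ∃ λ n → n ≤ D × Path v n
  reach v = from-point (point-surjective v)
    where
    from-point : (∃ λ x → ∃ λ y → ∃ λ z → point x y z ≡ v) → ∃ λ n → n ≤ D × Path v n
    from-point (x , y , z , point≡v) = subst (λ u → ∃ λ n → n ≤ D × Path u n) point≡v (point-within-D x y z)

  far : Vertex
  far = point (t-1 ℕ.+ 0 * t) (t-1 ℕ.+ 0 * t) (t-1 ℕ.+ 7 * t)

  t-1<t : t-1 < t
  t-1<t = n<1+n t-1

  point≡far⇒D≤ : ∀ x y z → point x y z ≡ far → D ≤ x ℕ.+ y ℕ.+ z
  point≡far⇒D≤ x y z eq =
    from-residues (point-≡⇒ (x / t) (y / t) (z / t) 0 0 7 (m%n<n x t) (m%n<n y t) (m%n<n z t) t-1<t t-1<t t-1<t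
                             (trans (sym (point-residues x y z)) eq))
    where
    restore : ∀ w → w % t ≡ t-1 → t-1 ℕ.+ (w / t) * t ≡ w
    restore w w%t≡t-1 = sym (trans (m≡m%n+[m/n]*n w t) (cong (ℕ._+ (w / t) * t) w%t≡t-1))
    from-residues : (x % t ≡ t-1 × y % t ≡ t-1 × z % t ≡ t-1) × + 84 ∣ weight (x / t) (y / t) (z / t) - + 49 →
                    D ≤ x ℕ.+ y ℕ.+ z
    from-residues ((x%t≡t-1 , y%t≡t-1 , z%t≡t-1) , 84∣w-49) = begin
      D                                                             ≡⟨ D≡3[t-1]+7t ⟩
      (t-1 ℕ.+ t-1 ℕ.+ t-1) ℕ.+ 7 * t                               ≤⟨ +-monoʳ-≤ _ (*-monoˡ-≤ t 7≤a+b+c) ⟩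
      (t-1 ℕ.+ t-1 ℕ.+ t-1) ℕ.+ (x / t ℕ.+ y / t ℕ.+ z / t) * t     ≡⟨ length-blocks t-1 t-1 t-1 (x / t) (y / t) (z / t) ⟨
      (t-1 ℕ.+ (x / t) * t) ℕ.+ (t-1 ℕ.+ (y / t) * t) ℕ.+ (t-1 ℕ.+ (z / t) * t)
        ≡⟨ cong₃ (λ u v w → u ℕ.+ v ℕ.+ w) (restore x x%t≡t-1) (restore y y%t≡t-1) (restore z z%t≡t-1) ⟩
      x ℕ.+ y ℕ.+ z ∎
      where
      open ≤-Reasoning
      7≤a+b+c : 7 ≤ x / t ℕ.+ y / t ℕ.+ z / t
      7≤a+b+c = 84∣weight-49⇒7≤a+b+c (x / t) (y / t) (z / t) 84∣w-49

  far-distance : ∀ n → Path far n → D ≤ n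
  far-distance n path with path⇒point path
  ... | x , y , z , x+y+z≡n , point≡far = subst (D ≤_) x+y+z≡n (point≡far⇒D≤ x y z point≡far)

  diameter : IsDiameter D
  diameter = reach , far , far-distance

  vertices : Vertex ↔ Fin (84 * t ^ 3)
  vertices = subst (λ n → Vertex ↔ Fin n) (count t) (↔-sym (↔-trans *↔× (↔-refl ×-↔ *↔×)))
    where
    count : ∀ n → n * (n * (84 * n)) ≡ 84 * (n * (n * (n * 1)))
    count = ℕ-Solver.solve-∀

proposition3 : (t : ℕ) → .{{_ : NonZero t}} →
    (Gt.Vertex t ↔ Fin (84 * t ^ 3)) × Gt.IsDiameter t (10 * t ∸ 3)
proposition3 (suc t-1) = Cayley.vertices t-1 , Cayley.diameter t-1
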